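{- Let $\omega$ be a primitive $8$-th root of unity and specialize $a=b=c=\omega$ in the matrices $\alpha,\beta,\gamma$ below. Let $L$ be a simple closed loop in the honeycomb graph $2H$, and let $h$ be the number of hexagons of $2H$ enclosed by $L$. Then the monodromy of the connection around $L$ equals $(-1)^h\begin{bmatrix}1&0\\0&1\end{bmatrix}$, regardless of the choice of basepoint on $L$.
   Context: $2H$ is the hexagonal tiling of the plane drawn with one family of edges horizontal, so edges come in three direction classes: horizontal, NE/SW and NW/SE. With $i=\sqrt{ -1}$, $$\alpha=\begin{bmatrix} ia&0\\0&\frac{1}{ia}\end{bmatrix},\quad \beta=\begin{bmatrix} ib& -ib-\frac{i}{b}\\ 0&\frac{1}{ib}\end{bmatrix},\quad \gamma=\begin{bmatrix}\frac{1}{ic}&0\\ -ic-\frac{i}{c}& ic\end{bmatrix}.$$ Traversing a NE/SW edge toward the northeast contributes $\alpha$ (southwest: $\alpha^{ -1}$); a NW/SE edge toward the northwest contributes $\beta$ (southeast: $\beta^{ -1}$); a horizontal edge toward the west contributes $\gamma$ (east: $\gamma^{ -1}$). The monodromy along a closed path $e_1,\dots,e_k$ starting at a basepoint is $M_{e_k}\cdots M_{e_1}$. -}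

module Defs where

open import Data.Bool using (Bool; true; false; T; _∧_; if_then_else_)
open import Data.Integer using (ℤ; +_; _+_; _-_; -_; _*_; _≤ᵇ_; 0ℤ; 1ℤ)
open import Data.Integer.Properties using (_≟_)
open import Data.Nat using (ℕ; zero; suc; _%_; _≤_)
open import Data.Product using (_×_; _,_)
open import Data.List using (List; []; _∷_; length; filterᵇ)
open import Data.Unit using (⊤)
open import Relation.Nullary.Decidable using (⌊_⌋)
open import Relation.Nullary using (¬_)
open import Relation.Binary.PropositionalEquality using (_≡_; refl)
open import Data.List.Relation.Unary.Unique.Propositional using (Unique)

-- The ring ℤ[ζ] ⊂ ℂ, ζ = e^{iπ/4}, as ℤ[x]/(x⁴+1).
-- An element  z0 + z1 ζ + z2 ζ² + z3 ζ³  (canonical representation).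
-- Every primitive 8th root of unity of ℂ lies in ℤ[ζ], and the imaginary
-- unit i = √-1 is ζ².

record Zζ : Set where
  constructor mk
  field
    c0 c1 c2 c3 : ℤ

open Zζ public

infixl 6 _⊕_
infixl 7 _⊗_

_⊕_ : Zζ → Zζ → Zζ
mk a0 a1 a2 a3 ⊕ mk b0 b1 b2 b3 = mk (a0 + b0) (a1 + b1) (a2 + b2) (a3 + b3)

⊖_ : Zζ → Zζ
⊖ mk a0 a1 a2 a3 = mk (- a0) (- a1) (- a2) (- a3)

-- multiplication using ζ⁴ = -1
_⊗_ : Zζ → Zζ → Zζ
mk a0 a1 a2 a3 ⊗ mk b0 b1 b2 b3 =
  mk (a0 * b0 - a1 * b3 - a2 * b2 - a3 * b1)
     (a0 * b1 + a1 * b0 - a2 * b3 - a3 * b2)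
     (a0 * b2 + a1 * b1 + a2 * b0 - a3 * b3)
     (a0 * b3 + a1 * b2 + a2 * b1 + a3 * b0)

fromℤ : ℤ → Zζ
fromℤ k = mk k 0ℤ 0ℤ 0ℤ

𝟘 𝟙 ζ : Zζ
𝟘 = fromℤ 0ℤ
𝟙 = fromℤ 1ℤ
ζ = mk 0ℤ 1ℤ 0ℤ 0ℤ

ι : Zζ
ι = ζ ⊗ ζ

_^ᶻ_ : Zζ → ℕ → Zζ
z ^ᶻ zero = 𝟙
z ^ᶻ suc n = z ⊗ (z ^ᶻ n)

IsPrimitive8thRoot : Zζ → Set
IsPrimitive8thRoot ω = (ω ^ᶻ 8 ≡ 𝟙) × ¬ (ω ^ᶻ 4 ≡ 𝟙)

-- inverses: for ω with ω⁸ = 1 we have ω⁻¹ = ω⁷ ; i⁻¹ = -i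
inv8 : Zζ → Zζ
inv8 ω = ω ^ᶻ 7

ι⁻¹ : Zζ
ι⁻¹ = ⊖ ι

ι-inv : ι ⊗ ι⁻¹ ≡ 𝟙
ι-inv = refl

record Mat : Set where
  constructor mat
  field
    m11 m12 m21 m22 : Zζ

infixl 7 _·_
_·_ : Mat → Mat → Mat
mat a b c d · mat e f g h = mat (a ⊗ e ⊕ b ⊗ g) (a ⊗ f ⊕ b ⊗ h) (c ⊗ e ⊕ d ⊗ g) (c ⊗ f ⊕ d ⊗ h)

I₂ : Mat
I₂ = mat 𝟙 𝟘 𝟘 𝟙

scale : Zζ → Mat → Mat
scale s (mat a b c d) = mat (s ⊗ a) (s ⊗ b) (s ⊗ c) (s ⊗ d)

-- inverse of a determinant-one matrix (adjugate); α, β, γ all have determinant 1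
invSL : Mat → Mat
invSL (mat a b c d) = mat d (⊖ b) (⊖ c) a

-- α, β, γ with a = b = c = ω  (1/ω = inv8 ω, 1/i = ι⁻¹)
α β γ : Zζ → Mat
α ω = mat (ι ⊗ ω) 𝟘 𝟘 (ι⁻¹ ⊗ inv8 ω)
β ω = mat (ι ⊗ ω) (⊖ (ι ⊗ ω) ⊕ ⊖ (ι ⊗ inv8 ω)) 𝟘 (ι⁻¹ ⊗ inv8 ω)
γ ω = mat (ι⁻¹ ⊗ inv8 ω) 𝟘 (⊖ (ι ⊗ ω) ⊕ ⊖ (ι ⊗ inv8 ω)) (ι ⊗ ω)

α-inv-ζ : α ζ · invSL (α ζ) ≡ I₂
α-inv-ζ = refl
β-inv-ζ : β ζ · invSL (β ζ) ≡ I₂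
β-inv-ζ = refl
γ-inv-ζ : γ ζ · invSL (γ ζ) ≡ I₂
γ-inv-ζ = refl

-- The honeycomb 2H (one family of edges horizontal).
-- Embedding: A(m,n) = (1,0) + m(3/2, √3/2) + n(3/2, -√3/2),  B(m,n) = A(m,n) + (1,0).
-- Edges:  A(m,n) — B(m,n)      horizontal (A is west end)
--         B(m,n) — A(m+1,n)    NE/SW      (A is NE end)
--         B(m,n) — A(m,n+1)    NW/SE      (B is NW end)
-- A-vertices have neighbours E, NW, SW; B-vertices have W, NE, SE.

data Kind : Set where
  𝔸 𝔹 : Kind

record Vertex : Set where
  constructor vx
  field
    kind : Kind
    m n  : ℤ

data Dir : Set where
  E W NE SW NW SE : Dir

allowed : Kind → Dir → Bool
allowed 𝔸 E  = true
allowed 𝔸 SW = true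
allowed 𝔸 NW = true
allowed 𝔹 W  = true
allowed 𝔹 NE = true
allowed 𝔹 SE = true
allowed _ _  = false

-- the neighbour in direction d (meaningful only when allowed)
step : Vertex → Dir → Vertex
step (vx 𝔸 m n) E  = vx 𝔹 m n
step (vx 𝔸 m n) SW = vx 𝔹 (m - 1ℤ) n
step (vx 𝔸 m n) NW = vx 𝔹 m (n - 1ℤ)
step (vx 𝔹 m n) W  = vx 𝔸 m n
step (vx 𝔹 m n) NE = vx 𝔸 (m + 1ℤ) n
step (vx 𝔹 m n) SE = vx 𝔸 m (n + 1ℤ)
step v _ = v

edgeMat : Zζ → Dir → Mat
edgeMat ω NE = α ω
edgeMat ω SW = invSL (α ω)
edgeMat ω NW = β ω
edgeMat ω SE = invSL (β ω)
edgeMat ω W  = γ ω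
edgeMat ω E  = invSL (γ ω)

monodromyFrom : Zζ → Mat → List Dir → Mat
monodromyFrom ω acc [] = acc
monodromyFrom ω acc (d ∷ ds) = monodromyFrom ω (edgeMat ω d · acc) ds

monodromy : Zζ → List Dir → Mat
monodromy ω ds = monodromyFrom ω I₂ ds

ValidWalk : Vertex → List Dir → Set
ValidWalk v [] = ⊤
ValidWalk v (d ∷ ds) = T (allowed (Vertex.kind v) d) × ValidWalk (step v d) ds

endpoint : Vertex → List Dir → Vertex
endpoint v [] = v
endpoint v (d ∷ ds) = endpoint (step v d) ds

-- the vertices v₀, …, v_{k-1} visited (the final return to v₀ is not listed)
loopVerts : Vertex → List Dir → List Vertex
loopVerts v [] = []
loopVerts v (d ∷ ds) = v ∷ loopVerts (step v d) ds

SimpleClosedLoop : Vertex → List Dir → Set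
SimpleClosedLoop v ds =
  ValidWalk v ds × endpoint v ds ≡ v × 3 ≤ length ds × Unique (loopVerts v ds)

-- Hexagon H(m,n) is the hexagon whose east vertex is A(m,n); its boundary is
-- A(m,n), B(m,n-1), A(m,n-1), B(m-1,n-1), A(m-1,n), B(m-1,n).
-- Horizontal edge A(p,q)—B(p,q) is labelled (p,q).  The vertical upward ray from
-- the centre of H(m,n) crosses exactly the horizontal edges (p,q) with
-- p + q = m + n - 1 and p ≥ m (transversally, at their midpoints), and meets no
-- other edge or vertex.  H is enclosed by L iff this ray crosses L an odd number of times.

horizEdges : Vertex → List Dir → List (ℤ × ℤ)
horizEdges v [] = []
horizEdges v (E ∷ ds) = (Vertex.m v , Vertex.n v) ∷ horizEdges (step v E) ds
horizEdges v (W ∷ ds) = (Vertex.m v , Vertex.n v) ∷ horizEdges (step v W) ds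
horizEdges v (d ∷ ds) = horizEdges (step v d) ds

rayCrosses : ℤ × ℤ → ℤ × ℤ → Bool
rayCrosses (m , n) (p , q) = ⌊ p + q ≟ m + n - 1ℤ ⌋ ∧ (m ≤ᵇ p)

Enclosed : Vertex → List Dir → ℤ × ℤ → Set
Enclosed v ds h = length (filterᵇ (rayCrosses h) (horizEdges v ds)) % 2 ≡ 1

signℤ : ℕ → ℤ
signℤ zero = 1ℤ
signℤ (suc h) = - signℤ h

-- At a primitive eighth root ω the edge matrices α, β, γ lie in SL₂, and the transports
-- X = α γ⁻¹ (from A(m,n) to A(m+1,n)) and Y = β⁻¹ γ⁻¹ (from A(m,n) to A(m,n+1)) satisfy
-- X² = Y² = −1 and YX = −XY: they generate a quaternion group. Choosing at every vertex a
-- frame G built from ±X and powers of −Y therefore turns every edge matrix into ±1, the sign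
-- −1 sitting exactly on the horizontal edges A(m,n)–B(m,n) with m even. So the monodromy of a
-- closed walk is (−1)^k, where k counts the traversals of such edges.
--
-- That k ≡ h (mod 2) is a double count over a large box of hexagons whose lower-left corner
-- L is even: summing over the box the parity of the number of times the upward ray from a
-- hexagon crosses the loop counts the enclosed hexagons, and it also counts every horizontal
-- edge (p,q) once per box hexagon below it on its antidiagonal, that is p − L + 1 times.
--
-- Since ω is only known abstractly, one first shows that the primitive eighth roots in ℤ[ζ]
-- are ζ, ζ³, ζ⁵, ζ⁷: a square root z of a root of unity satisfies (z z̄)² = 1, which forces
-- the coefficients of z into {−1, 0, 1}. At these four values the relations are computed.

module Submission where

open import Defs

open import Algebra.Bundles using (CommutativeRing; AbelianGroup)
open import Algebra.Structures using (IsCommutativeRing)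
import Algebra.Properties.Group as GroupProperties
open import Data.Bool using (Bool; true; false; T; _∧_; _∨_)
open import Data.Empty using (⊥; ⊥-elim)
open import Data.Fin as Fin using (Fin; toℕ; #_)
open import Data.Fin.Patterns using (0F; 1F; 2F; 3F; 4F; 5F; 6F; 7F)
import Data.Fin.Properties as FinP
open import Data.Integer as ℤ
  using (ℤ; +_; +[1+_]; -[1+_]; 0ℤ; 1ℤ; _+_; _*_; _-_; -_; ∣_∣; _≤ᵇ_)
import Data.Integer.Properties as ℤP
import Data.Integer.Tactic.RingSolver as ℤ-Solver
open import Data.List as List using (List; []; _∷_; length; filterᵇ)
open import Data.List.Extrema.Nat using (max; xs≤max)
open import Data.List.Membership.Propositional using (_∈_)
open import Data.List.Relation.Unary.All as All using (All; []; _∷_)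
import Data.List.Relation.Unary.All.Properties as AllP
open import Data.List.Relation.Unary.AllPairs using ([]; _∷_)
open import Data.List.Relation.Unary.Unique.Propositional using (Unique)
open import Data.Maybe using (Maybe; just; nothing)
open import Data.Nat as ℕ using (ℕ; zero; suc; z≤n; s≤s; parity)
import Data.Nat.Properties as ℕP
open import Data.Parity as ℙ using (Parity; 0ℙ; 1ℙ; _⁻¹)
import Data.Parity.Properties as ℙP
open import Data.Product using (_×_; _,_; ∃₂; ∃-syntax; proj₁; proj₂)
open import Data.Product.Properties using (≡-dec)
open import Data.Unit using (tt)
open import Data.Vec using (Vec) renaming ([] to []ᵥ; _∷_ to _∷ᵥ_)
open import Function using (_∘_)
open import Function.Bundles using (_⇔_; mk⇔; Equivalence)
open import Level using (0ℓ)
open import Relation.Binary.Definitions using (DecidableEquality)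
open import Relation.Binary.PropositionalEquality
open import Relation.Nullary using (¬_; contradiction)
open import Relation.Nullary.Decidable
  using (Dec; yes; no; _because_; does; T?; map′; toWitness; _→-dec_; _×-dec_; isYes≗does; does-⇔)
open import Relation.Nullary.Reflects using (invert)
open import Tactic.RingSolver using (solve-∀)
open import Tactic.RingSolver.Core.AlmostCommutativeRing using (AlmostCommutativeRing; fromCommutativeRing)
open import Tactic.RingSolver.NonReflective ℤ-Solver.ring
  using (Expr; Κ; Ι; module Ops) renaming (_⊕_ to _:+_; _⊗_ to _:*_; ⊝_ to :-_)
open import Algebra.Properties.CommutativeMonoid.Sum ℙP.+-0-commutativeMonoid
  using (sum-syntax; ∑-distrib-+; sum-cong-≗; sum-replicate-zero)

mk-cong : ∀ {a0 a1 a2 a3 b0 b1 b2 b3} → a0 ≡ b0 → a1 ≡ b1 → a2 ≡ b2 → a3 ≡ b3 →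
          mk a0 a1 a2 a3 ≡ mk b0 b1 b2 b3
mk-cong refl refl refl refl = refl

-- The reflective solver treats a coefficient of a nested product as an opaque atom, so the
-- operations of ℤ[ζ] are restated on coefficient expressions; their denotations are
-- definitionally the operations of Defs.
record ZζExpr (n : ℕ) : Set where
  constructor ⟨_,_,_,_⟩
  field
    e0 e1 e2 e3 : Expr ℤ n

module _ {n : ℕ} where
  open Ops using (⟦_⟧; ⟦_⇓⟧; prove)

  infixl 6 _⊕ₑ_
  infixl 7 _⊗ₑ_

  _⊕ₑ_ _⊗ₑ_ : ZζExpr n → ZζExpr n → ZζExpr n
  ⟨ a0 , a1 , a2 , a3 ⟩ ⊕ₑ ⟨ b0 , b1 , b2 , b3 ⟩ = ⟨ a0 :+ b0 , a1 :+ b1 , a2 :+ b2 , a3 :+ b3 ⟩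
  ⟨ a0 , a1 , a2 , a3 ⟩ ⊗ₑ ⟨ b0 , b1 , b2 , b3 ⟩ =
    ⟨ a0 :* b0 :+ :- (a1 :* b3) :+ :- (a2 :* b2) :+ :- (a3 :* b1)
    , a0 :* b1 :+ a1 :* b0 :+ :- (a2 :* b3) :+ :- (a3 :* b2)
    , a0 :* b2 :+ a1 :* b1 :+ a2 :* b0 :+ :- (a3 :* b3)
    , a0 :* b3 :+ a1 :* b2 :+ a2 :* b1 :+ a3 :* b0 ⟩

  ⊖ₑ_ conjₑ : ZζExpr n → ZζExpr n
  ⊖ₑ ⟨ a0 , a1 , a2 , a3 ⟩ = ⟨ :- a0 , :- a1 , :- a2 , :- a3 ⟩
  conjₑ ⟨ a0 , a1 , a2 , a3 ⟩ = ⟨ a0 , :- a3 , :- a2 , :- a1 ⟩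

  𝟘ₑ 𝟙ₑ : ZζExpr n
  𝟘ₑ = ⟨ Κ 0ℤ , Κ 0ℤ , Κ 0ℤ , Κ 0ℤ ⟩
  𝟙ₑ = ⟨ Κ 1ℤ , Κ 0ℤ , Κ 0ℤ , Κ 0ℤ ⟩

  ⟦_⟧ₑ ⟦_⇓⟧ₑ : ZζExpr n → Vec ℤ n → Zζ
  ⟦ ⟨ a0 , a1 , a2 , a3 ⟩ ⟧ₑ ρ = mk (⟦ a0 ⟧ ρ) (⟦ a1 ⟧ ρ) (⟦ a2 ⟧ ρ) (⟦ a3 ⟧ ρ)
  ⟦ ⟨ a0 , a1 , a2 , a3 ⟩ ⇓⟧ₑ ρ = mk (⟦ a0 ⇓⟧ ρ) (⟦ a1 ⇓⟧ ρ) (⟦ a2 ⇓⟧ ρ) (⟦ a3 ⇓⟧ ρ)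

  proveₑ : ∀ ρ (p q : ZζExpr n) → ⟦ p ⇓⟧ₑ ρ ≡ ⟦ q ⇓⟧ₑ ρ → ⟦ p ⟧ₑ ρ ≡ ⟦ q ⟧ₑ ρ
  proveₑ ρ ⟨ a0 , a1 , a2 , a3 ⟩ ⟨ b0 , b1 , b2 , b3 ⟩ nf≡ =
    mk-cong (prove ρ a0 b0 (cong c0 nf≡)) (prove ρ a1 b1 (cong c1 nf≡))
            (prove ρ a2 b2 (cong c2 nf≡)) (prove ρ a3 b3 (cong c3 nf≡))

private
  x̂ ŷ ẑ : ZζExpr 12
  x̂ = ⟨ Ι (# 0) , Ι (# 1) , Ι (# 2) , Ι (# 3) ⟩
  ŷ = ⟨ Ι (# 4) , Ι (# 5) , Ι (# 6) , Ι (# 7) ⟩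
  ẑ = ⟨ Ι (# 8) , Ι (# 9) , Ι (# 10) , Ι (# 11) ⟩

  env : Zζ → Zζ → Zζ → Vec ℤ 12
  env (mk a0 a1 a2 a3) (mk b0 b1 b2 b3) (mk c0 c1 c2 c3) =
    a0 ∷ᵥ a1 ∷ᵥ a2 ∷ᵥ a3 ∷ᵥ b0 ∷ᵥ b1 ∷ᵥ b2 ∷ᵥ b3 ∷ᵥ c0 ∷ᵥ c1 ∷ᵥ c2 ∷ᵥ c3 ∷ᵥ []ᵥ

Zζ-isCommutativeRing : IsCommutativeRing _≡_ _⊕_ _⊗_ ⊖_ 𝟘 𝟙
Zζ-isCommutativeRing = record
  { isRing = record
    { +-isAbelianGroup = record
      { isGroup = record
        { isMonoid = record
          { isSemigroup = record
            { isMagma = record { isEquivalence = isEquivalence ; ∙-cong = cong₂ _⊕_ }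
            ; assoc   = λ x y z → proveₑ (env x y z) (x̂ ⊕ₑ ŷ ⊕ₑ ẑ) (x̂ ⊕ₑ (ŷ ⊕ₑ ẑ)) refl
            }
          ; identity = (λ x → proveₑ (env x 𝟘 𝟘) (𝟘ₑ ⊕ₑ x̂) x̂ refl)
                     , (λ x → proveₑ (env x 𝟘 𝟘) (x̂ ⊕ₑ 𝟘ₑ) x̂ refl)
          }
        ; inverse = (λ x → proveₑ (env x 𝟘 𝟘) (⊖ₑ x̂ ⊕ₑ x̂) 𝟘ₑ refl)
                  , (λ x → proveₑ (env x 𝟘 𝟘) (x̂ ⊕ₑ ⊖ₑ x̂) 𝟘ₑ refl)
        ; ⁻¹-cong = cong ⊖_
        }
      ; comm = λ x y → proveₑ (env x y 𝟘) (x̂ ⊕ₑ ŷ) (ŷ ⊕ₑ x̂) refl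
      }
    ; *-cong     = cong₂ _⊗_
    ; *-assoc    = λ x y z → proveₑ (env x y z) (x̂ ⊗ₑ ŷ ⊗ₑ ẑ) (x̂ ⊗ₑ (ŷ ⊗ₑ ẑ)) refl
    ; *-identity = (λ x → proveₑ (env x 𝟘 𝟘) (𝟙ₑ ⊗ₑ x̂) x̂ refl)
                 , (λ x → proveₑ (env x 𝟘 𝟘) (x̂ ⊗ₑ 𝟙ₑ) x̂ refl)
    ; distrib    = (λ x y z → proveₑ (env x y z) (x̂ ⊗ₑ (ŷ ⊕ₑ ẑ)) (x̂ ⊗ₑ ŷ ⊕ₑ x̂ ⊗ₑ ẑ) refl)
                 , (λ x y z → proveₑ (env x y z) ((ŷ ⊕ₑ ẑ) ⊗ₑ x̂) (ŷ ⊗ₑ x̂ ⊕ₑ ẑ ⊗ₑ x̂) refl)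
    }
  ; *-comm = λ x y → proveₑ (env x y 𝟘) (x̂ ⊗ₑ ŷ) (ŷ ⊗ₑ x̂) refl
  }

Zζ-commutativeRing : CommutativeRing 0ℓ 0ℓ
Zζ-commutativeRing = record { isCommutativeRing = Zζ-isCommutativeRing }

open CommutativeRing Zζ-commutativeRing using (*-assoc; *-identityˡ; *-identityʳ)

Zζ-ring : AlmostCommutativeRing 0ℓ 0ℓ
Zζ-ring = fromCommutativeRing Zζ-commutativeRing 𝟘≟_
  where
  𝟘≟_ : ∀ x → Maybe (𝟘 ≡ x)
  𝟘≟ mk (+ zero) (+ zero) (+ zero) (+ zero) = just refl
  𝟘≟ _                                      = nothing

infix 4 _≟ᶻ_
_≟ᶻ_ : DecidableEquality Zζ
x ≟ᶻ y = map′ (cong fromCoefficients) (cong coefficients) (coefficients x ≟₄ coefficients y)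
  where
  coefficients : Zζ → ℤ × ℤ × ℤ × ℤ
  coefficients (mk a0 a1 a2 a3) = a0 , a1 , a2 , a3
  fromCoefficients : ℤ × ℤ × ℤ × ℤ → Zζ
  fromCoefficients (a0 , a1 , a2 , a3) = mk a0 a1 a2 a3
  _≟₄_ : DecidableEquality (ℤ × ℤ × ℤ × ℤ)
  _≟₄_ = ≡-dec ℤ._≟_ (≡-dec ℤ._≟_ (≡-dec ℤ._≟_ ℤ._≟_))

^ᶻ-+ : ∀ z m n → z ^ᶻ (m ℕ.+ n) ≡ z ^ᶻ m ⊗ z ^ᶻ n
^ᶻ-+ z zero    n = sym (*-identityˡ (z ^ᶻ n))
^ᶻ-+ z (suc m) n = trans (cong (z ⊗_) (^ᶻ-+ z m n)) (sym (*-assoc z (z ^ᶻ m) (z ^ᶻ n)))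

mat-cong : ∀ {a b c d a′ b′ c′ d′} → a ≡ a′ → b ≡ b′ → c ≡ c′ → d ≡ d′ →
           mat a b c d ≡ mat a′ b′ c′ d′
mat-cong refl refl refl refl = refl

·-assoc : ∀ A B C → (A · B) · C ≡ A · (B · C)
·-assoc (mat a b c d) (mat e f g h) (mat i j k l) =
  mat-cong (entry a b e f g h i k) (entry a b e f g h j l) (entry c d e f g h i k) (entry c d e f g h j l)
  where
  entry : ∀ a b e f g h i k →
          (a ⊗ e ⊕ b ⊗ g) ⊗ i ⊕ (a ⊗ f ⊕ b ⊗ h) ⊗ k ≡ a ⊗ (e ⊗ i ⊕ f ⊗ k) ⊕ b ⊗ (g ⊗ i ⊕ h ⊗ k)
  entry = solve-∀ Zζ-ring

·-identityˡ : ∀ A → I₂ · A ≡ A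
·-identityˡ (mat a b c d) = mat-cong (first a c) (first b d) (second a c) (second b d)
  where
  first : ∀ x y → 𝟙 ⊗ x ⊕ 𝟘 ⊗ y ≡ x
  first = solve-∀ Zζ-ring
  second : ∀ x y → 𝟘 ⊗ x ⊕ 𝟙 ⊗ y ≡ y
  second = solve-∀ Zζ-ring

·-identityʳ : ∀ A → A · I₂ ≡ A
·-identityʳ (mat a b c d) = mat-cong (first a b) (second a b) (first c d) (second c d)
  where
  first : ∀ x y → x ⊗ 𝟙 ⊕ y ⊗ 𝟘 ≡ x
  first = solve-∀ Zζ-ring
  second : ∀ x y → x ⊗ 𝟘 ⊕ y ⊗ 𝟙 ≡ y
  second = solve-∀ Zζ-ring

undo-· : ∀ M′ M A B → M′ · M ≡ I₂ → M · A ≡ B → M′ · B ≡ A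
undo-· M′ M A B M′·M≡I M·A≡B = begin
  M′ · B        ≡⟨ cong (M′ ·_) M·A≡B ⟨
  M′ · (M · A)  ≡⟨ ·-assoc M′ M A ⟨
  M′ · M · A    ≡⟨ cong (_· A) M′·M≡I ⟩
  I₂ · A        ≡⟨ ·-identityˡ A ⟩
  A             ∎
  where open ≡-Reasoning

neg : Mat → Mat
neg = scale (⊖ 𝟙)

neg-involutive : ∀ A → neg (neg A) ≡ A
neg-involutive (mat a b c d) = mat-cong (twice a) (twice b) (twice c) (twice d)
  where
  twice : ∀ x → ⊖ 𝟙 ⊗ (⊖ 𝟙 ⊗ x) ≡ x
  twice = solve-∀ Zζ-ring

·-neg : ∀ A B → A · neg B ≡ neg (A · B)
·-neg (mat a b c d) (mat e f g h) = mat-cong (entry a b e g) (entry a b f h) (entry c d e g) (entry c d f h)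
  where
  entry : ∀ a b e g → a ⊗ (⊖ 𝟙 ⊗ e) ⊕ b ⊗ (⊖ 𝟙 ⊗ g) ≡ ⊖ 𝟙 ⊗ (a ⊗ e ⊕ b ⊗ g)
  entry = solve-∀ Zζ-ring

neg-· : ∀ A B → neg A · B ≡ neg (A · B)
neg-· (mat a b c d) (mat e f g h) = mat-cong (entry a b e g) (entry a b f h) (entry c d e g) (entry c d f h)
  where
  entry : ∀ a b e g → (⊖ 𝟙 ⊗ a) ⊗ e ⊕ (⊖ 𝟙 ⊗ b) ⊗ g ≡ ⊖ 𝟙 ⊗ (a ⊗ e ⊕ b ⊗ g)
  entry = solve-∀ Zζ-ring

sign : Parity → Mat → Mat
sign 0ℙ A = A
sign 1ℙ A = neg A

sign-sign : ∀ p q A → sign p (sign q A) ≡ sign (p ℙ.+ q) A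
sign-sign 0ℙ q  A = refl
sign-sign 1ℙ 0ℙ A = refl
sign-sign 1ℙ 1ℙ A = neg-involutive A

sign-involutive : ∀ p A → sign p (sign p A) ≡ A
sign-involutive p A = trans (sign-sign p p A) (cong (λ q → sign q A) (ℙP.p+p≡0ℙ p))

·-sign : ∀ p A B → A · sign p B ≡ sign p (A · B)
·-sign 0ℙ A B = refl
·-sign 1ℙ A B = ·-neg A B

sign-· : ∀ p A B → sign p A · B ≡ sign p (A · B)
sign-· 0ℙ A B = refl
sign-· 1ℙ A B = neg-· A B

det : Mat → Zζ
det (mat a b c d) = a ⊗ d ⊕ ⊖ (b ⊗ c)

SL₂ : Mat → Set
SL₂ A = det A ≡ 𝟙

det-invSL : ∀ A → det (invSL A) ≡ det A
det-invSL (mat a b c d) = swap a b c d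
  where
  swap : ∀ a b c d → d ⊗ a ⊕ ⊖ (⊖ b ⊗ ⊖ c) ≡ a ⊗ d ⊕ ⊖ (b ⊗ c)
  swap = solve-∀ Zζ-ring

invSL-involutive : ∀ A → invSL (invSL A) ≡ A
invSL-involutive (mat a b c d) = mat-cong refl (⊖-involutive b) (⊖-involutive c) refl
  where
  ⊖-involutive : ∀ x → ⊖ ⊖ x ≡ x
  ⊖-involutive = solve-∀ Zζ-ring

·-adjugate : ∀ A → A · invSL A ≡ scale (det A) I₂
·-adjugate (mat a b c d) =
  mat-cong (diagonal a b c d) (off-diagonal a b c d) (off-diagonal′ a b c d) (diagonal′ a b c d)
  where
  diagonal : ∀ a b c d → a ⊗ d ⊕ b ⊗ ⊖ c ≡ (a ⊗ d ⊕ ⊖ (b ⊗ c)) ⊗ 𝟙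
  diagonal = solve-∀ Zζ-ring
  diagonal′ : ∀ a b c d → c ⊗ ⊖ b ⊕ d ⊗ a ≡ (a ⊗ d ⊕ ⊖ (b ⊗ c)) ⊗ 𝟙
  diagonal′ = solve-∀ Zζ-ring
  off-diagonal : ∀ a b c d → a ⊗ ⊖ b ⊕ b ⊗ a ≡ (a ⊗ d ⊕ ⊖ (b ⊗ c)) ⊗ 𝟘
  off-diagonal = solve-∀ Zζ-ring
  off-diagonal′ : ∀ a b c d → c ⊗ d ⊕ d ⊗ ⊖ c ≡ (a ⊗ d ⊕ ⊖ (b ⊗ c)) ⊗ 𝟘
  off-diagonal′ = solve-∀ Zζ-ring

·-invSL : ∀ A → SL₂ A → A · invSL A ≡ I₂
·-invSL A detA≡1 = trans (·-adjugate A) (cong (λ δ → scale δ I₂) detA≡1)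

invSL-· : ∀ A → SL₂ A → invSL A · A ≡ I₂
invSL-· A detA≡1 = begin
  invSL A · A               ≡⟨ cong (invSL A ·_) (invSL-involutive A) ⟨
  invSL A · invSL (invSL A) ≡⟨ ·-invSL (invSL A) (trans (det-invSL A) detA≡1) ⟩
  I₂                        ∎
  where open ≡-Reasoning

HasRightInverse : Mat → Set
HasRightInverse A = ∃[ K ] A · K ≡ I₂

·-hasRightInverse : ∀ A B → HasRightInverse A → HasRightInverse B → HasRightInverse (A · B)
·-hasRightInverse A B (K , A·K≡I) (L , B·L≡I) = L · K , (begin
  A · B · (L · K)   ≡⟨ ·-assoc A B (L · K) ⟩
  A · (B · (L · K)) ≡⟨ cong (A ·_) (·-assoc B L K) ⟨
  A · (B · L · K)   ≡⟨ cong (λ M → A · (M · K)) B·L≡I ⟩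
  A · (I₂ · K)      ≡⟨ cong (A ·_) (·-identityˡ K) ⟩
  A · K             ≡⟨ A·K≡I ⟩
  I₂                ∎)
  where open ≡-Reasoning

sign-hasRightInverse : ∀ p A → HasRightInverse A → HasRightInverse (sign p A)
sign-hasRightInverse p A (K , A·K≡I) = sign p K , (begin
  sign p A · sign p K     ≡⟨ sign-· p A (sign p K) ⟩
  sign p (A · sign p K)   ≡⟨ cong (sign p) (·-sign p A K) ⟩
  sign p (sign p (A · K)) ≡⟨ sign-involutive p (A · K) ⟩
  A · K                   ≡⟨ A·K≡I ⟩
  I₂                      ∎)
  where open ≡-Reasoning

-- The roots of unity in ℤ[ζ]

-- complex conjugation, ζ ↦ ζ⁻¹ = −ζ³
conj : Zζ → Zζ
conj (mk a0 a1 a2 a3) = mk a0 (- a3) (- a2) (- a1)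

conj-⊗ : ∀ x y → conj (x ⊗ y) ≡ conj x ⊗ conj y
conj-⊗ x y = proveₑ (env x y 𝟘) (conjₑ (x̂ ⊗ₑ ŷ)) (conjₑ x̂ ⊗ₑ conjₑ ŷ) refl

PowerOfζ : Zζ → Set
PowerOfζ z = ∃[ j ] z ≡ ζ ^ᶻ toℕ {8} j

NormOne : Zζ → Set
NormOne z = (z ⊗ conj z) ⊗ (z ⊗ conj z) ≡ 𝟙

-- z z̄ = S + T (ζ − ζ³) with S, T ∈ ℤ, and (ζ − ζ³)² = 2
norm²-constant : ∀ z → let n = z ⊗ conj z in
                 c0 (n ⊗ n) ≡ c0 n * c0 n + (c1 n * c1 n + c1 n * c1 n)
norm²-constant z = Ops.prove (env z 𝟘 𝟘) (e0 (n̂ ⊗ₑ n̂)) (e0 n̂ :* e0 n̂ :+ (e1 n̂ :* e1 n̂ :+ e1 n̂ :* e1 n̂)) refl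
  where
  open ZζExpr
  n̂ = x̂ ⊗ₑ conjₑ x̂

private
  square≡∣∣² : ∀ a → a * a ≡ + (∣ a ∣ ℕ.* ∣ a ∣)
  square≡∣∣² (+ zero) = refl
  square≡∣∣² +[1+ n ] = refl
  square≡∣∣² -[1+ n ] = refl

  square≤1 : ∀ k → k ℕ.* k ℕ.≤ 1 → k ℕ.≤ 1
  square≤1 zero          _        = z≤n
  square≤1 (suc zero)    _        = ℕP.≤-refl
  square≤1 (suc (suc k)) (s≤s ())

  sum-of-squares : ∀ a0 a1 a2 a3 →
    a0 * a0 - a1 * - a1 - a2 * - a2 - a3 * - a3 ≡ a0 * a0 + a1 * a1 + a2 * a2 + a3 * a3
  sum-of-squares = ℤ-Solver.solve-∀

-- With s = Σ aᵢ² = c0 (z z̄), the constant coefficient of (z z̄)² is s² + 2t² = 1.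
norm-one⇒small : ∀ a0 a1 a2 a3 → NormOne (mk a0 a1 a2 a3) →
                 ∣ a0 ∣ ℕ.≤ 1 × ∣ a1 ∣ ℕ.≤ 1 × ∣ a2 ∣ ℕ.≤ 1 × ∣ a3 ∣ ℕ.≤ 1
norm-one⇒small a0 a1 a2 a3 norm≡1 =
  small a0 (≤s₃ (≤s₂ (ℕP.m≤m+n (sq a0) (sq a1)))) ,
  small a1 (≤s₃ (≤s₂ (ℕP.m≤n+m (sq a1) (sq a0)))) ,
  small a2 (≤s₃ (ℕP.m≤n+m (sq a2) (sq a0 ℕ.+ sq a1))) ,
  small a3 (ℕP.m≤n+m (sq a3) (sq a0 ℕ.+ sq a1 ℕ.+ sq a2))
  where
  open ≡-Reasoning
  z = mk a0 a1 a2 a3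
  n = z ⊗ conj z
  sq : ℤ → ℕ
  sq a = ∣ a ∣ ℕ.* ∣ a ∣
  s t : ℕ
  s = sq a0 ℕ.+ sq a1 ℕ.+ sq a2 ℕ.+ sq a3
  t = sq (c1 n)
  c0n≡s : c0 n ≡ + s
  c0n≡s = begin
    c0 n                                  ≡⟨ sum-of-squares a0 a1 a2 a3 ⟩
    a0 * a0 + a1 * a1 + a2 * a2 + a3 * a3 ≡⟨ cong₂ _+_ (cong₂ _+_ (cong₂ _+_ (square≡∣∣² a0) (square≡∣∣² a1))
                                                                  (square≡∣∣² a2))
                                                       (square≡∣∣² a3) ⟩
    + s                                   ∎
  s²+2t≡1 : s ℕ.* s ℕ.+ (t ℕ.+ t) ≡ 1
  s²+2t≡1 = ℤP.+-injective (begin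
    + (s ℕ.* s) + (+ t + + t)
      ≡⟨ cong₂ (λ u v → u + (v + v)) (sym (ℤP.pos-* s s)) (square≡∣∣² (c1 n)) ⟨
    + s * + s + (c1 n * c1 n + c1 n * c1 n)
      ≡⟨ cong (λ u → u * u + (c1 n * c1 n + c1 n * c1 n)) c0n≡s ⟨
    c0 n * c0 n + (c1 n * c1 n + c1 n * c1 n)
      ≡⟨ norm²-constant z ⟨
    c0 (n ⊗ n)
      ≡⟨ cong c0 norm≡1 ⟩
    1ℤ ∎)
  s≤1 : s ℕ.≤ 1
  s≤1 = square≤1 s (subst (s ℕ.* s ℕ.≤_) s²+2t≡1 (ℕP.m≤m+n (s ℕ.* s) (t ℕ.+ t)))
  ≤s₂ : ∀ {k} → k ℕ.≤ sq a0 ℕ.+ sq a1 → k ℕ.≤ sq a0 ℕ.+ sq a1 ℕ.+ sq a2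
  ≤s₂ k≤ = ℕP.≤-trans k≤ (ℕP.m≤m+n _ (sq a2))
  ≤s₃ : ∀ {k} → k ℕ.≤ sq a0 ℕ.+ sq a1 ℕ.+ sq a2 → k ℕ.≤ s
  ≤s₃ k≤ = ℕP.≤-trans k≤ (ℕP.m≤m+n _ (sq a3))
  small : ∀ a → sq a ℕ.≤ s → ∣ a ∣ ℕ.≤ 1
  small a a²≤s = square≤1 ∣ a ∣ (ℕP.≤-trans a²≤s s≤1)

private
  digit : Fin 3 → ℤ
  digit 0F = -[1+ 0 ]
  digit 1F = 0ℤ
  digit 2F = 1ℤ

  digit-of : ∀ a → ∣ a ∣ ℕ.≤ 1 → ∃[ t ] a ≡ digit t
  digit-of (+ zero)        _        = 1F , refl
  digit-of (+ suc zero)    _        = 2F , refl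
  digit-of -[1+ zero ]     _        = 0F , refl
  digit-of (+ suc (suc _)) (s≤s ())
  digit-of -[1+ suc _ ]    (s≤s ())

  fromDigits : Fin 3 → Fin 3 → Fin 3 → Fin 3 → Zζ
  fromDigits t0 t1 t2 t3 = mk (digit t0) (digit t1) (digit t2) (digit t3)

  digits-norm-one⇒power-of-ζ : ∀ t0 t1 t2 t3 →
    NormOne (fromDigits t0 t1 t2 t3) → PowerOfζ (fromDigits t0 t1 t2 t3)
  digits-norm-one⇒power-of-ζ = toWitness {a? = FinP.all? λ t0 → FinP.all? λ t1 → FinP.all? λ t2 →
    FinP.all? λ t3 → let z = fromDigits t0 t1 t2 t3 in
    ((z ⊗ conj z) ⊗ (z ⊗ conj z) ≟ᶻ 𝟙) →-dec FinP.any? λ j → z ≟ᶻ ζ ^ᶻ toℕ j} tt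

  ζʲ·conj≡1 : ∀ j → ζ ^ᶻ toℕ {8} j ⊗ conj (ζ ^ᶻ toℕ j) ≡ 𝟙
  ζʲ·conj≡1 = toWitness {a? = FinP.all? λ j → ζ ^ᶻ toℕ j ⊗ conj (ζ ^ᶻ toℕ j) ≟ᶻ 𝟙} tt

norm-one⇒power-of-ζ : ∀ z → NormOne z → PowerOfζ z
norm-one⇒power-of-ζ (mk a0 a1 a2 a3) norm≡1 =
  let a0≤1 , a1≤1 , a2≤1 , a3≤1 = norm-one⇒small a0 a1 a2 a3 norm≡1
      t0 , a0≡ = digit-of a0 a0≤1
      t1 , a1≡ = digit-of a1 a1≤1
      t2 , a2≡ = digit-of a2 a2≤1
      t3 , a3≡ = digit-of a3 a3≤1
      z≡digits = mk-cong a0≡ a1≡ a2≡ a3≡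
  in subst PowerOfζ (sym z≡digits) (digits-norm-one⇒power-of-ζ t0 t1 t2 t3 (subst NormOne z≡digits norm≡1))

square-root-of-power : ∀ z → PowerOfζ (z ⊗ z) → PowerOfζ z
square-root-of-power z (k , z²≡ζᵏ) = norm-one⇒power-of-ζ z (begin
  (z ⊗ conj z) ⊗ (z ⊗ conj z)    ≡⟨ interchange z (conj z) ⟩
  (z ⊗ z) ⊗ (conj z ⊗ conj z)    ≡⟨ cong ((z ⊗ z) ⊗_) (conj-⊗ z z) ⟨
  (z ⊗ z) ⊗ conj (z ⊗ z)         ≡⟨ cong (λ u → u ⊗ conj u) z²≡ζᵏ ⟩
  ζ ^ᶻ toℕ k ⊗ conj (ζ ^ᶻ toℕ k) ≡⟨ ζʲ·conj≡1 k ⟩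
  𝟙                              ∎)
  where
  open ≡-Reasoning
  interchange : ∀ a b → (a ⊗ b) ⊗ (a ⊗ b) ≡ (a ⊗ a) ⊗ (b ⊗ b)
  interchange = solve-∀ Zζ-ring

eighth-root⇒power-of-ζ : ∀ ω → ω ^ᶻ 8 ≡ 𝟙 → PowerOfζ ω
eighth-root⇒power-of-ζ ω ω⁸≡1 =
  square-root-of-power ω (subst PowerOfζ (cong (ω ⊗_) (*-identityʳ ω)) (
  square-root-of-power (ω ^ᶻ 2) (subst PowerOfζ (^ᶻ-+ ω 2 2) (
  square-root-of-power (ω ^ᶻ 4) (0F , trans (sym (^ᶻ-+ ω 4 4)) ω⁸≡1)))))

-- The quaternion relations at a primitive eighth root

-- the transports along A(m,n) → B(m,n) → A(m+1,n) and A(m,n) → B(m,n) → A(m,n+1)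
X Y : Zζ → Mat
X ω = α ω · invSL (γ ω)
Y ω = invSL (β ω) · invSL (γ ω)

record QuaternionRelations (a b c X Y : Mat) : Set where
  constructor quaternion-relations
  field
    a-SL₂  : SL₂ a
    b-SL₂  : SL₂ b
    c-SL₂  : SL₂ c
    X≡     : a · invSL c ≡ X
    Y≡     : invSL b · invSL c ≡ Y
    X²≡-I  : X · X ≡ neg I₂
    Y²≡-I  : Y · Y ≡ neg I₂
    YX≡-XY : Y · X ≡ neg (X · Y)

private
  odd-power-relations : ∀ j → ¬ ((ζ ^ᶻ toℕ {8} j) ^ᶻ 4 ≡ 𝟙) →
    let ω = ζ ^ᶻ toℕ j in QuaternionRelations (α ω) (β ω) (γ ω) (X ω) (Y ω)
  odd-power-relations 0F ω⁴≢1 = contradiction refl ω⁴≢1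
  odd-power-relations 1F _    = quaternion-relations refl refl refl refl refl refl refl refl
  odd-power-relations 2F ω⁴≢1 = contradiction refl ω⁴≢1
  odd-power-relations 3F _    = quaternion-relations refl refl refl refl refl refl refl refl
  odd-power-relations 4F ω⁴≢1 = contradiction refl ω⁴≢1
  odd-power-relations 5F _    = quaternion-relations refl refl refl refl refl refl refl refl
  odd-power-relations 6F ω⁴≢1 = contradiction refl ω⁴≢1
  odd-power-relations 7F _    = quaternion-relations refl refl refl refl refl refl refl refl

primitive⇒quaternion-relations : ∀ ω → IsPrimitive8thRoot ω →
                                 QuaternionRelations (α ω) (β ω) (γ ω) (X ω) (Y ω)
primitive⇒quaternion-relations ω (ω⁸≡1 , ω⁴≢1) = from-power ω ω⁴≢1 (eighth-root⇒power-of-ζ ω ω⁸≡1)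
  where
  from-power : ∀ ω → ¬ (ω ^ᶻ 4 ≡ 𝟙) → PowerOfζ ω → QuaternionRelations (α ω) (β ω) (γ ω) (X ω) (Y ω)
  from-power .(ζ ^ᶻ toℕ j) ω⁴≢1 (j , refl) = odd-power-relations j ω⁴≢1

-- Gauges in which every edge matrix is ±1

parityℤ : ℤ → Parity
parityℤ (+ n)    = parity n
parityℤ -[1+ n ] = parity (suc n)

parity-suc : ∀ n → parity (suc n) ≡ parity n ⁻¹
parity-suc n = sym (ℙP.⁻¹-selfInverse (ℙP.suc-homo-⁻¹ n))

parityℤ-suc : ∀ i → parityℤ (i + 1ℤ) ≡ parityℤ i ⁻¹
parityℤ-suc (+ n)        = trans (cong parity (ℕP.+-comm n 1)) (parity-suc n)
parityℤ-suc -[1+ zero ]  = refl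
parityℤ-suc -[1+ suc n ] = parity-suc n

parityℤ-neg : ∀ n → parityℤ (- (+ n)) ≡ parity n
parityℤ-neg zero    = refl
parityℤ-neg (suc n) = refl

walkSign : (Vertex → Dir → Parity) → Vertex → List Dir → Parity
walkSign σ v []       = 0ℙ
walkSign σ v (d ∷ ds) = σ v d ℙ.+ walkSign σ (step v d) ds

module _ (ω : Zζ) (G : Vertex → Mat) (σ : Vertex → Dir → Parity)
         (gauge-step : ∀ v d → T (allowed (Vertex.kind v) d) →
                       edgeMat ω d · G v ≡ sign (σ v d) (G (step v d))) where

  monodromyFrom-gauge : ∀ v ds K p → ValidWalk v ds →
    monodromyFrom ω (sign p (G v · K)) ds ≡ sign (p ℙ.+ walkSign σ v ds) (G (endpoint v ds) · K)
  monodromyFrom-gauge v []       K p _ = cong (λ q → sign q (G v · K)) (sym (ℙP.+-identityʳ p))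
  monodromyFrom-gauge v (d ∷ ds) K p (d-allowed , valid) = begin
    monodromyFrom ω (edgeMat ω d · sign p (G v · K)) ds
      ≡⟨ cong (λ A → monodromyFrom ω A ds) transport ⟩
    monodromyFrom ω (sign (p ℙ.+ σ v d) (G w · K)) ds
      ≡⟨ monodromyFrom-gauge w ds K (p ℙ.+ σ v d) valid ⟩
    sign (p ℙ.+ σ v d ℙ.+ walkSign σ w ds) (G (endpoint w ds) · K)
      ≡⟨ cong (λ q → sign q (G (endpoint w ds) · K)) (ℙP.+-assoc p (σ v d) (walkSign σ w ds)) ⟩
    sign (p ℙ.+ walkSign σ v (d ∷ ds)) (G (endpoint v (d ∷ ds)) · K) ∎
    where
    open ≡-Reasoning
    w = step v d
    transport : edgeMat ω d · sign p (G v · K) ≡ sign (p ℙ.+ σ v d) (G w · K)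
    transport = begin
      edgeMat ω d · sign p (G v · K)   ≡⟨ ·-sign p (edgeMat ω d) (G v · K) ⟩
      sign p (edgeMat ω d · (G v · K)) ≡⟨ cong (sign p) (·-assoc (edgeMat ω d) (G v) K) ⟨
      sign p (edgeMat ω d · G v · K)   ≡⟨ cong (λ A → sign p (A · K)) (gauge-step v d d-allowed) ⟩
      sign p (sign (σ v d) (G w) · K)  ≡⟨ cong (sign p) (sign-· (σ v d) (G w) K) ⟩
      sign p (sign (σ v d) (G w · K))  ≡⟨ sign-sign p (σ v d) (G w · K) ⟩
      sign (p ℙ.+ σ v d) (G w · K)     ∎

  closed-walk-monodromy : ∀ v ds → HasRightInverse (G v) → ValidWalk v ds → endpoint v ds ≡ v →
                          monodromy ω ds ≡ sign (walkSign σ v ds) I₂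
  closed-walk-monodromy v ds (K , G·K≡I) valid closed = begin
    monodromyFrom ω I₂ ds                          ≡⟨ cong (λ A → monodromyFrom ω A ds) G·K≡I ⟨
    monodromyFrom ω (G v · K) ds                   ≡⟨ monodromyFrom-gauge v ds K 0ℙ valid ⟩
    sign (walkSign σ v ds) (G (endpoint v ds) · K) ≡⟨ cong (λ u → sign (walkSign σ v ds) (G u · K)) closed ⟩
    sign (walkSign σ v ds) (G v · K)               ≡⟨ cong (sign (walkSign σ v ds)) G·K≡I ⟩
    sign (walkSign σ v ds) I₂                      ∎
    where open ≡-Reasoning

horizontalSign : Vertex → Dir → Parity
horizontalSign v E = parityℤ (Vertex.m v) ⁻¹
horizontalSign v W = parityℤ (Vertex.m v) ⁻¹
horizontalSign v _ = 0ℙ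

module QuaternionGauge {a b c X Y : Mat} (relations : QuaternionRelations a b c X Y) where

  open QuaternionRelations relations
  open ≡-Reasoning

  edge : Dir → Mat
  edge NE = a
  edge SW = invSL a
  edge NW = b
  edge SE = invSL b
  edge W  = c
  edge E  = invSL c

  -Y·Y≡I : neg Y · Y ≡ I₂
  -Y·Y≡I = begin
    neg Y · Y      ≡⟨ neg-· Y Y ⟩
    neg (Y · Y)    ≡⟨ cong neg Y²≡-I ⟩
    neg (neg I₂)   ≡⟨ neg-involutive I₂ ⟩
    I₂             ∎

  X-invertible : HasRightInverse X
  X-invertible = subst HasRightInverse X≡
    (·-hasRightInverse a (invSL c) (invSL a , ·-invSL a a-SL₂) (c , invSL-· c c-SL₂))

  Y-invertible : HasRightInverse Y
  Y-invertible = subst HasRightInverse Y≡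
    (·-hasRightInverse (invSL b) (invSL c) (b , invSL-· b b-SL₂) (c , invSL-· c c-SL₂))

  -- Unfolding the gauge during conversion checking would expand it into ℤ[ζ]-arithmetic,
  -- so outside this block it is only accessed through the equations G-𝔸 and G-𝔹.
  opaque
    P : Parity → Mat
    P 0ℙ = I₂
    P 1ℙ = neg X

    -- Q n = (−Y)ⁿ, using (−Y)⁻¹ = Y
    Q : ℤ → Mat
    Q (+ zero)     = I₂
    Q (+ suc n)    = neg Y · Q (+ n)
    Q -[1+ zero ]  = Y
    Q -[1+ suc n ] = Y · Q -[1+ n ]

    G : Vertex → Mat
    G (vx 𝔸 m n) = P (parityℤ m) · Q n
    G (vx 𝔹 m n) = sign (parityℤ m ⁻¹) (invSL c · G (vx 𝔸 m n))

    G-𝔸 : ∀ m n → G (vx 𝔸 m n) ≡ P (parityℤ m) · Q n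
    G-𝔸 m n = refl

    G-𝔹 : ∀ m n → G (vx 𝔹 m n) ≡ sign (parityℤ m ⁻¹) (invSL c · G (vx 𝔸 m n))
    G-𝔹 m n = refl

    Q-suc : ∀ n → Q (n + 1ℤ) ≡ neg Y · Q n
    Q-suc (+ n)        = cong (λ k → Q (+ k)) (ℕP.+-comm n 1)
    Q-suc -[1+ zero ]  = sym -Y·Y≡I
    Q-suc -[1+ suc n ] = sym (undo-· (neg Y) Y (Q -[1+ n ]) (Y · Q -[1+ n ]) -Y·Y≡I refl)

    X·P : ∀ p → sign (p ⁻¹) (X · P p) ≡ P (p ⁻¹)
    X·P 0ℙ = cong neg (·-identityʳ X)
    X·P 1ℙ = begin
      X · neg X      ≡⟨ ·-neg X X ⟩
      neg (X · X)    ≡⟨ cong neg X²≡-I ⟩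
      neg (neg I₂)   ≡⟨ neg-involutive I₂ ⟩
      I₂             ∎

    Y·P : ∀ p → sign (p ⁻¹) (Y · P p) ≡ P p · neg Y
    Y·P 0ℙ = trans (cong neg (·-identityʳ Y)) (sym (·-identityˡ (neg Y)))
    Y·P 1ℙ = begin
      Y · neg X           ≡⟨ ·-neg Y X ⟩
      neg (Y · X)         ≡⟨ cong neg YX≡-XY ⟩
      neg (neg (X · Y))   ≡⟨ cong neg (·-neg X Y) ⟨
      neg (X · neg Y)     ≡⟨ neg-· X (neg Y) ⟨
      neg X · neg Y       ∎

    P-invertible : ∀ p → HasRightInverse (P p)
    P-invertible 0ℙ = I₂ , ·-identityʳ I₂
    P-invertible 1ℙ = sign-hasRightInverse 1ℙ X X-invertible

    Q-invertible : ∀ n → HasRightInverse (Q n)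
    Q-invertible (+ zero)     = I₂ , ·-identityʳ I₂
    Q-invertible (+ suc n)    = ·-hasRightInverse (neg Y) (Q (+ n))
                                  (sign-hasRightInverse 1ℙ Y Y-invertible) (Q-invertible (+ n))
    Q-invertible -[1+ zero ]  = Y-invertible
    Q-invertible -[1+ suc n ] = ·-hasRightInverse Y (Q -[1+ n ]) Y-invertible (Q-invertible -[1+ n ])

    G-invertible : ∀ v → HasRightInverse (G v)
    G-invertible (vx 𝔸 m n) = ·-hasRightInverse (P (parityℤ m)) (Q n) (P-invertible (parityℤ m)) (Q-invertible n)
    G-invertible (vx 𝔹 m n) = sign-hasRightInverse (parityℤ m ⁻¹) (invSL c · G (vx 𝔸 m n))
      (·-hasRightInverse (invSL c) (G (vx 𝔸 m n)) (c , invSL-· c c-SL₂) (G-invertible (vx 𝔸 m n)))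

  east : ∀ m n → invSL c · G (vx 𝔸 m n) ≡ sign (parityℤ m ⁻¹) (G (vx 𝔹 m n))
  east m n = begin
    invSL c · G (vx 𝔸 m n)
      ≡⟨ sign-involutive (parityℤ m ⁻¹) (invSL c · G (vx 𝔸 m n)) ⟨
    sign (parityℤ m ⁻¹) (sign (parityℤ m ⁻¹) (invSL c · G (vx 𝔸 m n)))
      ≡⟨ cong (sign (parityℤ m ⁻¹)) (G-𝔹 m n) ⟨
    sign (parityℤ m ⁻¹) (G (vx 𝔹 m n)) ∎

  west : ∀ m n → c · G (vx 𝔹 m n) ≡ sign (parityℤ m ⁻¹) (G (vx 𝔸 m n))
  west m n = begin
    c · G (vx 𝔹 m n)
      ≡⟨ cong (c ·_) (G-𝔹 m n) ⟩
    c · sign (parityℤ m ⁻¹) (invSL c · G (vx 𝔸 m n))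
      ≡⟨ ·-sign (parityℤ m ⁻¹) c (invSL c · G (vx 𝔸 m n)) ⟩
    sign (parityℤ m ⁻¹) (c · (invSL c · G (vx 𝔸 m n)))
      ≡⟨ cong (sign (parityℤ m ⁻¹)) (undo-· c (invSL c) (G (vx 𝔸 m n)) _ (·-invSL c c-SL₂) refl) ⟩
    sign (parityℤ m ⁻¹) (G (vx 𝔸 m n)) ∎

  leave-𝔹 : ∀ M T m n → M · invSL c ≡ T →
            M · G (vx 𝔹 m n) ≡ sign (parityℤ m ⁻¹) (T · P (parityℤ m)) · Q n
  leave-𝔹 M T m n M·c⁻¹≡T = begin
    M · G (vx 𝔹 m n)
      ≡⟨ cong (M ·_) (G-𝔹 m n) ⟩
    M · sign (parityℤ m ⁻¹) (invSL c · G (vx 𝔸 m n))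
      ≡⟨ ·-sign (parityℤ m ⁻¹) M (invSL c · G (vx 𝔸 m n)) ⟩
    sign (parityℤ m ⁻¹) (M · (invSL c · G (vx 𝔸 m n)))
      ≡⟨ cong (sign (parityℤ m ⁻¹)) (·-assoc M (invSL c) (G (vx 𝔸 m n))) ⟨
    sign (parityℤ m ⁻¹) (M · invSL c · G (vx 𝔸 m n))
      ≡⟨ cong (λ N → sign (parityℤ m ⁻¹) (N · G (vx 𝔸 m n))) M·c⁻¹≡T ⟩
    sign (parityℤ m ⁻¹) (T · G (vx 𝔸 m n))
      ≡⟨ cong (λ N → sign (parityℤ m ⁻¹) (T · N)) (G-𝔸 m n) ⟩
    sign (parityℤ m ⁻¹) (T · (P (parityℤ m) · Q n))
      ≡⟨ cong (sign (parityℤ m ⁻¹)) (·-assoc T (P (parityℤ m)) (Q n)) ⟨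
    sign (parityℤ m ⁻¹) (T · P (parityℤ m) · Q n)
      ≡⟨ sign-· (parityℤ m ⁻¹) (T · P (parityℤ m)) (Q n) ⟨
    sign (parityℤ m ⁻¹) (T · P (parityℤ m)) · Q n ∎

  northeast : ∀ m n → a · G (vx 𝔹 m n) ≡ G (vx 𝔸 (m + 1ℤ) n)
  northeast m n = begin
    a · G (vx 𝔹 m n)                               ≡⟨ leave-𝔹 a X m n X≡ ⟩
    sign (parityℤ m ⁻¹) (X · P (parityℤ m)) · Q n  ≡⟨ cong (_· Q n) (X·P (parityℤ m)) ⟩
    P (parityℤ m ⁻¹) · Q n                         ≡⟨ cong (λ r → P r · Q n) (parityℤ-suc m) ⟨
    P (parityℤ (m + 1ℤ)) · Q n                     ≡⟨ G-𝔸 (m + 1ℤ) n ⟨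
    G (vx 𝔸 (m + 1ℤ) n)                            ∎

  southeast : ∀ m n → invSL b · G (vx 𝔹 m n) ≡ G (vx 𝔸 m (n + 1ℤ))
  southeast m n = begin
    invSL b · G (vx 𝔹 m n)                         ≡⟨ leave-𝔹 (invSL b) Y m n Y≡ ⟩
    sign (parityℤ m ⁻¹) (Y · P (parityℤ m)) · Q n  ≡⟨ cong (_· Q n) (Y·P (parityℤ m)) ⟩
    P (parityℤ m) · neg Y · Q n                    ≡⟨ ·-assoc (P (parityℤ m)) (neg Y) (Q n) ⟩
    P (parityℤ m) · (neg Y · Q n)                  ≡⟨ cong (P (parityℤ m) ·_) (Q-suc n) ⟨
    P (parityℤ m) · Q (n + 1ℤ)                     ≡⟨ G-𝔸 m (n + 1ℤ) ⟨
    G (vx 𝔸 m (n + 1ℤ))                            ∎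

  private
    -1+1 : ∀ i → i - 1ℤ + 1ℤ ≡ i
    -1+1 = ℤ-Solver.solve-∀

  southwest : ∀ m n → invSL a · G (vx 𝔸 m n) ≡ G (vx 𝔹 (m - 1ℤ) n)
  southwest m n = subst (λ k → invSL a · G (vx 𝔸 k n) ≡ G (vx 𝔹 (m - 1ℤ) n)) (-1+1 m)
    (undo-· (invSL a) a (G (vx 𝔹 (m - 1ℤ) n)) _ (invSL-· a a-SL₂) (northeast (m - 1ℤ) n))

  northwest : ∀ m n → b · G (vx 𝔸 m n) ≡ G (vx 𝔹 m (n - 1ℤ))
  northwest m n = subst (λ k → b · G (vx 𝔸 m k) ≡ G (vx 𝔹 m (n - 1ℤ))) (-1+1 n)
    (undo-· b (invSL b) (G (vx 𝔹 m (n - 1ℤ))) _ (·-invSL b b-SL₂) (southeast m (n - 1ℤ)))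

  gauge-step : ∀ v d → T (allowed (Vertex.kind v) d) →
               edge d · G v ≡ sign (horizontalSign v d) (G (step v d))
  gauge-step (vx 𝔸 m n) E  _ = east m n
  gauge-step (vx 𝔸 m n) SW _ = southwest m n
  gauge-step (vx 𝔸 m n) NW _ = northwest m n
  gauge-step (vx 𝔹 m n) W  _ = west m n
  gauge-step (vx 𝔹 m n) NE _ = northeast m n
  gauge-step (vx 𝔹 m n) SE _ = southeast m n
  gauge-step (vx 𝔸 _ _) W  ()
  gauge-step (vx 𝔸 _ _) NE ()
  gauge-step (vx 𝔸 _ _) SE ()
  gauge-step (vx 𝔹 _ _) E  ()
  gauge-step (vx 𝔹 _ _) SW ()
  gauge-step (vx 𝔹 _ _) NW ()

-- Counting enclosed hexagons

indicator : Bool → Parity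
indicator false = 0ℙ
indicator true  = 1ℙ

indicator-∧ : ∀ x y → indicator (x ∧ y) ≡ indicator x ℙ.* indicator y
indicator-∧ false y = refl
indicator-∧ true  y = refl

indicator-∨ : ∀ x y → (T x → T y → ⊥) → indicator (x ∨ y) ≡ indicator x ℙ.+ indicator y
indicator-∨ false y     _        = refl
indicator-∨ true  false _        = refl
indicator-∨ true  true  disjoint = ⊥-elim (disjoint tt tt)

sumOver : {A : Set} → List A → (A → Parity) → Parity
sumOver []       f = 0ℙ
sumOver (x ∷ xs) f = f x ℙ.+ sumOver xs f

sumOver-cong : ∀ {A : Set} {f g : A → Parity} xs → All (λ x → f x ≡ g x) xs → sumOver xs f ≡ sumOver xs g
sumOver-cong []       []            = refl
sumOver-cong (x ∷ xs) (fx≡gx ∷ eqs) = cong₂ ℙ._+_ fx≡gx (sumOver-cong xs eqs)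

parity-filter : ∀ {A : Set} (P : A → Bool) xs → parity (length (filterᵇ P xs)) ≡ sumOver xs (indicator ∘ P)
parity-filter P []       = refl
parity-filter P (x ∷ xs) with P x
... | true  = trans (parity-suc (length (filterᵇ P xs))) (cong _⁻¹ (parity-filter P xs))
... | false = parity-filter P xs

∑-sumOver : ∀ N {A : Set} (f : Fin N → A → Parity) xs →
            ∑[ i < N ] sumOver xs (f i) ≡ sumOver xs (λ x → ∑[ i < N ] f i x)
∑-sumOver N f []       = sum-replicate-zero N
∑-sumOver N f (x ∷ xs) = trans (∑-distrib-+ (λ i → f i x) (λ i → sumOver xs (f i)))
                               (cong (∑[ i < N ] f i x ℙ.+_) (∑-sumOver N f xs))

∑-δ : ∀ {N} (i₀ : Fin N) c → ∑[ i < N ] (indicator (does (i FinP.≟ i₀)) ℙ.* c) ≡ c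
∑-δ {suc N} Fin.zero     c = trans (cong (c ℙ.+_) (sum-replicate-zero N)) (ℙP.+-identityʳ c)
∑-δ {suc N} (Fin.suc i₀) c = ∑-δ i₀ c

private
  ≤ᵇ-suc : ∀ m n → (suc m ℕ.≤ᵇ suc n) ≡ (m ℕ.≤ᵇ n)
  ≤ᵇ-suc zero    n = refl
  ≤ᵇ-suc (suc m) n = refl

∑-≤ : ∀ {N} (t : Fin N) → ∑[ i < N ] indicator (toℕ i ℕ.≤ᵇ toℕ t) ≡ parity (suc (toℕ t))
∑-≤ {suc N} Fin.zero    = cong (1ℙ ℙ.+_) (sum-replicate-zero N)
∑-≤ {suc N} (Fin.suc t) = begin
  1ℙ ℙ.+ ∑[ i < N ] indicator (suc (toℕ i) ℕ.≤ᵇ suc (toℕ t))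
    ≡⟨ cong (1ℙ ℙ.+_) (sum-cong-≗ {N} λ i → cong indicator (≤ᵇ-suc (toℕ i) (toℕ t))) ⟩
  1ℙ ℙ.+ ∑[ i < N ] indicator (toℕ i ℕ.≤ᵇ toℕ t)
    ≡⟨ cong (1ℙ ℙ.+_) (∑-≤ t) ⟩
  parity (suc (toℕ t)) ⁻¹
    ≡⟨ ℙP.suc-homo-⁻¹ (toℕ t) ⟩
  parity (suc (suc (toℕ t))) ∎
  where open ≡-Reasoning

parityℤ-shift : ∀ L k → parityℤ L ≡ 0ℙ → parityℤ (L + + k) ≡ parity k
parityℤ-shift L zero    L-even = trans (cong parityℤ (ℤP.+-identityʳ L)) L-even
parityℤ-shift L (suc k) L-even = begin
  parityℤ (L + + suc k)      ≡⟨ cong (λ x → parityℤ (L + + x)) (ℕP.+-comm k 1) ⟨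
  parityℤ (L + (+ k + 1ℤ))   ≡⟨ cong parityℤ (ℤP.+-assoc L (+ k) 1ℤ) ⟨
  parityℤ (L + + k + 1ℤ)     ≡⟨ parityℤ-suc (L + + k) ⟩
  parityℤ (L + + k) ⁻¹       ≡⟨ cong _⁻¹ (parityℤ-shift L k L-even) ⟩
  parity k ⁻¹                ≡⟨ parity-suc k ⟨
  parity (suc k)             ∎
  where open ≡-Reasoning

infix 4 _≟ₚ_
_≟ₚ_ : DecidableEquality (ℤ × ℤ)
_≟ₚ_ = ≡-dec ℤ._≟_ ℤ._≟_

open import Data.List.Membership.DecPropositional _≟ₚ_ using (_∈?_)

private
  does⇒ : ∀ {P : Set} (P? : Dec P) → T (does P?) → P
  does⇒ (true because [p]) _ = invert [p]

  open GroupProperties (AbelianGroup.group ℤP.+-0-abelianGroup) using (∙-cancelˡ; ∙-cancelʳ)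

  translate-≤ : ∀ L x y → L + x ℤ.≤ L + y → x ℤ.≤ y
  translate-≤ L x y L+x≤L+y = subst₂ ℤ._≤_ (cancel L x) (cancel L y) (ℤP.+-monoʳ-≤ (- L) L+x≤L+y)
    where
    cancel : ∀ L x → - L + (L + x) ≡ x
    cancel = ℤ-Solver.solve-∀

  parity≡1ℙ⇔odd : ∀ n → (parity n ≡ 1ℙ) ⇔ (n ℕ.% 2 ≡ 1)
  parity≡1ℙ⇔odd zero          = mk⇔ (λ ()) (λ ())
  parity≡1ℙ⇔odd (suc zero)    = mk⇔ (λ _ → refl) (λ _ → refl)
  parity≡1ℙ⇔odd (suc (suc n)) = parity≡1ℙ⇔odd n

  ≢1ℙ⇒≡0ℙ : ∀ {p} → ¬ (p ≡ 1ℙ) → p ≡ 0ℙ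
  ≢1ℙ⇒≡0ℙ {0ℙ} _    = refl
  ≢1ℙ⇒≡0ℙ {1ℙ} p≢1ℙ = contradiction refl p≢1ℙ

-- The box of hexagons H(m,n) with L ≤ m < L + N and L ≤ m + n < L + N.
module Box (L : ℤ) (N : ℕ) where

  hex : Fin N → Fin N → ℤ × ℤ
  hex i j = L + + toℕ i , (L + + toℕ j) - (L + + toℕ i)

  InBox : ℤ × ℤ → Set
  InBox h = ∃₂ λ i j → h ≡ hex i j

  -- a horizontal edge (p,q) whose column and antidiagonal p + q + 1 meet the box
  EdgeInBox : ℤ × ℤ → Set
  EdgeInBox (p , q) = ∃₂ λ (t j₀ : Fin N) → p ≡ L + + toℕ t × p + q + 1ℤ ≡ L + + toℕ j₀

  ∑□ : (ℤ × ℤ → Parity) → Parity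
  ∑□ f = ∑[ i < N ] ∑[ j < N ] f (hex i j)

  ∑□-cong : ∀ {f g} → (∀ h → f h ≡ g h) → ∑□ f ≡ ∑□ g
  ∑□-cong f≗g = sum-cong-≗ {N} λ i → sum-cong-≗ {N} λ j → f≗g (hex i j)

  ∑□-+ : ∀ f g → ∑□ (λ h → f h ℙ.+ g h) ≡ ∑□ f ℙ.+ ∑□ g
  ∑□-+ f g = trans (sum-cong-≗ {N} λ i → ∑-distrib-+ (λ j → f (hex i j)) (λ j → g (hex i j)))
                   (∑-distrib-+ (λ i → ∑[ j < N ] f (hex i j)) (λ i → ∑[ j < N ] g (hex i j)))

  ∑□-zero : ∑□ (λ _ → 0ℙ) ≡ 0ℙ
  ∑□-zero = trans (sum-cong-≗ {N} λ i → sum-replicate-zero N) (sum-replicate-zero N)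

  ∑□-sumOver : ∀ {A : Set} (f : ℤ × ℤ → A → Parity) xs →
               ∑□ (λ h → sumOver xs (f h)) ≡ sumOver xs (λ x → ∑□ (λ h → f h x))
  ∑□-sumOver f xs = trans (sum-cong-≗ {N} λ i → ∑-sumOver N (λ j → f (hex i j)) xs)
                          (∑-sumOver N (λ i x → ∑[ j < N ] f (hex i j) x) xs)

  hex-injective : ∀ {i j i₀ j₀} → hex i j ≡ hex i₀ j₀ → j ≡ j₀ × i ≡ i₀
  hex-injective {i} {j} {i₀} {j₀} hex≡ = j≡j₀ , i≡i₀
    where
    Li≡Li₀ : L + + toℕ i ≡ L + + toℕ i₀
    Li≡Li₀ = cong proj₁ hex≡
    i≡i₀ : i ≡ i₀
    i≡i₀ = FinP.toℕ-injective (ℤP.+-injective (∙-cancelˡ L (+ toℕ i) (+ toℕ i₀) Li≡Li₀))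
    Lj≡Lj₀ : L + + toℕ j ≡ L + + toℕ j₀
    Lj≡Lj₀ = ∙-cancelʳ (- (L + + toℕ i₀)) (L + + toℕ j) (L + + toℕ j₀)
               (trans (cong (λ u → (L + + toℕ j) - u) (sym Li≡Li₀)) (cong proj₂ hex≡))
    j≡j₀ : j ≡ j₀
    j≡j₀ = FinP.toℕ-injective (ℤP.+-injective (∙-cancelˡ L (+ toℕ j) (+ toℕ j₀) Lj≡Lj₀))

  ∑□-point : ∀ i₀ j₀ → ∑□ (λ h → indicator (does (h ≟ₚ hex i₀ j₀))) ≡ 1ℙ
  ∑□-point i₀ j₀ = begin
    ∑[ i < N ] ∑[ j < N ] indicator (does (hex i j ≟ₚ hex i₀ j₀))
      ≡⟨ sum-cong-≗ {N} (λ i → sum-cong-≗ {N} λ j →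
           cong indicator (does-⇔ hex≡⇔ (hex i j ≟ₚ hex i₀ j₀) (j FinP.≟ j₀ ×-dec i FinP.≟ i₀))) ⟩
    ∑[ i < N ] ∑[ j < N ] indicator (does (j FinP.≟ j₀) ∧ does (i FinP.≟ i₀))
      ≡⟨ sum-cong-≗ {N} (λ i → sum-cong-≗ {N} λ j → indicator-∧ (does (j FinP.≟ j₀)) (does (i FinP.≟ i₀))) ⟩
    ∑[ i < N ] ∑[ j < N ] (indicator (does (j FinP.≟ j₀)) ℙ.* indicator (does (i FinP.≟ i₀)))
      ≡⟨ sum-cong-≗ {N} (λ i → ∑-δ j₀ (indicator (does (i FinP.≟ i₀)))) ⟩
    ∑[ i < N ] indicator (does (i FinP.≟ i₀))
      ≡⟨ sum-cong-≗ {N} (λ i → ℙP.*-identityʳ (indicator (does (i FinP.≟ i₀)))) ⟨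
    ∑[ i < N ] (indicator (does (i FinP.≟ i₀)) ℙ.* 1ℙ)
      ≡⟨ ∑-δ i₀ 1ℙ ⟩
    1ℙ ∎
    where
    open ≡-Reasoning
    hex≡⇔ : ∀ {i j} → hex i j ≡ hex i₀ j₀ ⇔ (j ≡ j₀ × i ≡ i₀)
    hex≡⇔ = mk⇔ hex-injective λ (j≡j₀ , i≡i₀) → cong₂ (λ j i → hex i j) j≡j₀ i≡i₀

  ∑□-members : ∀ hs → Unique hs → All InBox hs →
               ∑□ (λ h → indicator (does (h ∈? hs))) ≡ parity (length hs)
  ∑□-members []       _               _                               = ∑□-zero
  ∑□-members (x ∷ xs) (x∉xs ∷ unique) ((i₀ , j₀ , x≡hex) ∷ xs-in-box) = begin
    ∑□ (λ h → indicator (does (h ∈? x ∷ xs)))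
      ≡⟨ ∑□-cong (λ h → indicator-∨ (does (h ≟ₚ x)) (does (h ∈? xs)) (disjoint h)) ⟩
    ∑□ (λ h → indicator (does (h ≟ₚ x)) ℙ.+ indicator (does (h ∈? xs)))
      ≡⟨ ∑□-+ (λ h → indicator (does (h ≟ₚ x))) (λ h → indicator (does (h ∈? xs))) ⟩
    ∑□ (λ h → indicator (does (h ≟ₚ x))) ℙ.+ ∑□ (λ h → indicator (does (h ∈? xs)))
      ≡⟨ cong₂ ℙ._+_ (subst (λ y → ∑□ (λ h → indicator (does (h ≟ₚ y))) ≡ 1ℙ) (sym x≡hex)
                            (∑□-point i₀ j₀))
                     (∑□-members xs unique xs-in-box) ⟩
    1ℙ ℙ.+ parity (length xs)
      ≡⟨ parity-suc (length xs) ⟨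
    parity (length (x ∷ xs)) ∎
    where
    open ≡-Reasoning
    disjoint : ∀ h → T (does (h ≟ₚ x)) → T (does (h ∈? xs)) → ⊥
    disjoint h h≡x h∈xs = All.lookup x∉xs (subst (_∈ xs) (does⇒ (h ≟ₚ x) h≡x) (does⇒ (h ∈? xs) h∈xs)) refl

  rayCrosses-hex : ∀ p q (t j₀ : Fin N) → p ≡ L + + toℕ t → p + q + 1ℤ ≡ L + + toℕ j₀ →
                   ∀ i j → rayCrosses (hex i j) (p , q) ≡ does (j FinP.≟ j₀) ∧ (toℕ i ℕ.≤ᵇ toℕ t)
  rayCrosses-hex p q t j₀ p≡L+t p+q+1≡L+j₀ i j = cong₂ _∧_
    (trans (isYes≗does (p + q ℤ.≟ m + n - 1ℤ)) (does-⇔ same-antidiagonal (p + q ℤ.≟ m + n - 1ℤ) (j FinP.≟ j₀)))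
    (does-⇔ below (T? (m ≤ᵇ p)) (T? (toℕ i ℕ.≤ᵇ toℕ t)))
    where
    m = proj₁ (hex i j)
    n = proj₂ (hex i j)
    antidiagonal : ∀ L a b → (L + a) + ((L + b) - (L + a)) - 1ℤ ≡ L + b - 1ℤ
    antidiagonal = ℤ-Solver.solve-∀
    pred-suc : ∀ x → x + 1ℤ - 1ℤ ≡ x
    pred-suc = ℤ-Solver.solve-∀
    p+q≡ : p + q ≡ L + + toℕ j₀ - 1ℤ
    p+q≡ = trans (sym (pred-suc (p + q))) (cong (_- 1ℤ) p+q+1≡L+j₀)
    same-antidiagonal : p + q ≡ m + n - 1ℤ ⇔ j ≡ j₀
    same-antidiagonal = mk⇔
      (λ on → sym (FinP.toℕ-injective (ℤP.+-injective (∙-cancelˡ L (+ toℕ j₀) (+ toℕ j)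
                (∙-cancelʳ (- 1ℤ) _ _ (trans (sym p+q≡) (trans on (antidiagonal L (+ toℕ i) (+ toℕ j)))))))))
      (λ j≡j₀ → trans p+q≡ (sym (trans (antidiagonal L (+ toℕ i) (+ toℕ j))
                                        (cong (λ k → L + + toℕ k - 1ℤ) j≡j₀))))
    below : T (m ≤ᵇ p) ⇔ T (toℕ i ℕ.≤ᵇ toℕ t)
    below = mk⇔
      (λ le → ℕP.≤⇒≤ᵇ (ℤP.drop‿+≤+ (translate-≤ L (+ toℕ i) (+ toℕ t)
                                      (subst (m ℤ.≤_) p≡L+t (ℤP.≤ᵇ⇒≤ le)))))
      (λ le → ℤP.≤⇒≤ᵇ (subst (m ℤ.≤_) (sym p≡L+t) (ℤP.+-monoʳ-≤ L (ℤ.+≤+ (ℕP.≤ᵇ⇒≤ _ _ le)))))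

  -- the box hexagons whose ray crosses (p,q) are the p − L + 1 ones on its antidiagonal with m ≤ p
  ∑□-crossing : parityℤ L ≡ 0ℙ → ∀ e → EdgeInBox e →
                ∑□ (λ h → indicator (rayCrosses h e)) ≡ parityℤ (proj₁ e) ⁻¹
  ∑□-crossing L-even (p , q) (t , j₀ , p≡L+t , p+q+1≡L+j₀) = begin
    ∑[ i < N ] ∑[ j < N ] indicator (rayCrosses (hex i j) (p , q))
      ≡⟨ sum-cong-≗ {N} (λ i → sum-cong-≗ {N} λ j →
           cong indicator (rayCrosses-hex p q t j₀ p≡L+t p+q+1≡L+j₀ i j)) ⟩
    ∑[ i < N ] ∑[ j < N ] indicator (does (j FinP.≟ j₀) ∧ (toℕ i ℕ.≤ᵇ toℕ t))
      ≡⟨ sum-cong-≗ {N} (λ i → sum-cong-≗ {N} λ j →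
           indicator-∧ (does (j FinP.≟ j₀)) (toℕ i ℕ.≤ᵇ toℕ t)) ⟩
    ∑[ i < N ] ∑[ j < N ] (indicator (does (j FinP.≟ j₀)) ℙ.* indicator (toℕ i ℕ.≤ᵇ toℕ t))
      ≡⟨ sum-cong-≗ {N} (λ i → ∑-δ j₀ (indicator (toℕ i ℕ.≤ᵇ toℕ t))) ⟩
    ∑[ i < N ] indicator (toℕ i ℕ.≤ᵇ toℕ t)
      ≡⟨ ∑-≤ t ⟩
    parity (suc (toℕ t))
      ≡⟨ parity-suc (toℕ t) ⟩
    parity (toℕ t) ⁻¹
      ≡⟨ cong _⁻¹ (parityℤ-shift L (toℕ t) L-even) ⟨
    parityℤ (L + + toℕ t) ⁻¹
      ≡⟨ cong (λ x → parityℤ x ⁻¹) p≡L+t ⟨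
    parityℤ p ⁻¹ ∎
    where open ≡-Reasoning

  enclosed-parity-in-box : parityℤ L ≡ 0ℙ → ∀ es hs → Unique hs → All InBox hs → All EdgeInBox es →
                           (∀ x → (x ∈ hs) ⇔ (length (filterᵇ (rayCrosses x) es) ℕ.% 2 ≡ 1)) →
                           parity (length hs) ≡ sumOver es (λ e → parityℤ (proj₁ e) ⁻¹)
  enclosed-parity-in-box L-even es hs unique hs-in-box es-in-box enclosed = begin
    parity (length hs)
      ≡⟨ ∑□-members hs unique hs-in-box ⟨
    ∑□ (λ h → indicator (does (h ∈? hs)))
      ≡⟨ ∑□-cong membership ⟩
    ∑□ (λ h → parity (length (filterᵇ (rayCrosses h) es)))
      ≡⟨ ∑□-cong (λ h → parity-filter (rayCrosses h) es) ⟩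
    ∑□ (λ h → sumOver es (indicator ∘ rayCrosses h))
      ≡⟨ ∑□-sumOver (λ h e → indicator (rayCrosses h e)) es ⟩
    sumOver es (λ e → ∑□ (λ h → indicator (rayCrosses h e)))
      ≡⟨ sumOver-cong es (All.map (∑□-crossing L-even _) es-in-box) ⟩
    sumOver es (λ e → parityℤ (proj₁ e) ⁻¹) ∎
    where
    open ≡-Reasoning
    membership : ∀ h → indicator (does (h ∈? hs)) ≡ parity (length (filterᵇ (rayCrosses h) es))
    membership h with h ∈? hs
    ... | yes h∈hs = sym (Equivalence.from (parity≡1ℙ⇔odd crossings) (Equivalence.to (enclosed h) h∈hs))
      where crossings = length (filterᵇ (rayCrosses h) es)
    ... | no  h∉hs =
      sym (≢1ℙ⇒≡0ℙ (h∉hs ∘ Equivalence.from (enclosed h) ∘ Equivalence.to (parity≡1ℙ⇔odd crossings)))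
      where crossings = length (filterᵇ (rayCrosses h) es)

private
  size : ℤ × ℤ → ℕ
  size (x , y) = ∣ x ∣ ℕ.+ ∣ x + y ∣ ℕ.+ ∣ x + y + 1ℤ ∣

  offset : ∀ B x → ∣ x ∣ ℕ.≤ B → ∃[ t ] x ≡ - (+ B) + + toℕ {suc (B ℕ.+ B)} t
  offset B (+ a) a≤B = Fin.fromℕ< B+a<N , (begin
    + a                                   ≡⟨ cancel (+ B) (+ a) ⟨
    - (+ B) + + (B ℕ.+ a)                 ≡⟨ cong (λ k → - (+ B) + + k) (FinP.toℕ-fromℕ< B+a<N) ⟨
    - (+ B) + + toℕ (Fin.fromℕ< B+a<N)    ∎)
    where
    open ≡-Reasoning
    B+a<N : B ℕ.+ a ℕ.< suc (B ℕ.+ B)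
    B+a<N = s≤s (ℕP.+-monoʳ-≤ B a≤B)
    cancel : ∀ b a → - b + (b + a) ≡ a
    cancel = ℤ-Solver.solve-∀
  offset B -[1+ a ] 1+a≤B = Fin.fromℕ< B∸1+a<N , (begin
    -[1+ a ]
      ≡⟨ cancel (+ suc a) (+ (B ℕ.∸ suc a)) ⟨
    - (+ (suc a ℕ.+ (B ℕ.∸ suc a))) + + (B ℕ.∸ suc a)
      ≡⟨ cong (λ b → - (+ b) + + (B ℕ.∸ suc a)) (ℕP.m+[n∸m]≡n 1+a≤B) ⟩
    - (+ B) + + (B ℕ.∸ suc a)
      ≡⟨ cong (λ k → - (+ B) + + k) (FinP.toℕ-fromℕ< B∸1+a<N) ⟨
    - (+ B) + + toℕ (Fin.fromℕ< B∸1+a<N) ∎)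
    where
    open ≡-Reasoning
    B∸1+a<N : B ℕ.∸ suc a ℕ.< suc (B ℕ.+ B)
    B∸1+a<N = s≤s (ℕP.≤-trans (ℕP.m∸n≤m B (suc a)) (ℕP.m≤m+n B B))
    cancel : ∀ x y → - (x + y) + y ≡ - x
    cancel = ℤ-Solver.solve-∀

  fits : ∀ B {z} → size z ℕ.≤ B → let open Box (- (+ B)) (suc (B ℕ.+ B)) in InBox z × EdgeInBox z
  fits B {x , y} size≤B =
    let i , x≡      = offset B x (≤B (ℕP.m≤m+n ∣ x ∣ ∣ x + y ∣))
        j , x+y≡    = offset B (x + y) (≤B (ℕP.m≤n+m ∣ x + y ∣ ∣ x ∣))
        j₀ , x+y+1≡ = offset B (x + y + 1ℤ) (ℕP.≤-trans (ℕP.m≤n+m _ (∣ x ∣ ℕ.+ ∣ x + y ∣)) size≤B)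
    in (i , j , cong₂ _,_ x≡ (trans (sym (x+y-x x y)) (cong₂ _-_ x+y≡ x≡))) , (i , j₀ , x≡ , x+y+1≡)
    where
    ≤B : ∀ {k} → k ℕ.≤ ∣ x ∣ ℕ.+ ∣ x + y ∣ → k ℕ.≤ B
    ≤B k≤ = ℕP.≤-trans (ℕP.≤-trans k≤ (ℕP.m≤m+n _ ∣ x + y + 1ℤ ∣)) size≤B
    x+y-x : ∀ x y → x + y - x ≡ y
    x+y-x = ℤ-Solver.solve-∀

enclosed-parity : ∀ es hs → Unique hs →
                  (∀ x → (x ∈ hs) ⇔ (length (filterᵇ (rayCrosses x) es) ℕ.% 2 ≡ 1)) →
                  parity (length hs) ≡ sumOver es (λ e → parityℤ (proj₁ e) ⁻¹)
enclosed-parity es hs unique enclosed =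
  enclosed-parity-in-box L-even es hs unique
    (All.map (proj₁ ∘ fits B) (AllP.++⁻ʳ es small)) (All.map (proj₂ ∘ fits B) (AllP.++⁻ˡ es small)) enclosed
  where
  B₀ = max 0 (List.map size (es List.++ hs))
  B = B₀ ℕ.+ B₀
  open Box (- (+ B)) (suc (B ℕ.+ B))
  small : All (λ z → size z ℕ.≤ B) (es List.++ hs)
  small = All.map (λ size≤B₀ → ℕP.≤-trans size≤B₀ (ℕP.m≤m+n B₀ B₀))
                  (AllP.map⁻ (xs≤max 0 (List.map size (es List.++ hs))))
  L-even : parityℤ (- (+ B)) ≡ 0ℙ
  L-even = trans (parityℤ-neg B) (trans (ℙP.+-homo-+ B₀ B₀) (ℙP.p+p≡0ℙ (parity B₀)))

walkSign-horizontal : ∀ v ds →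
                      walkSign horizontalSign v ds ≡ sumOver (horizEdges v ds) (λ e → parityℤ (proj₁ e) ⁻¹)
walkSign-horizontal v []        = refl
walkSign-horizontal v (E  ∷ ds) = cong (parityℤ (Vertex.m v) ⁻¹ ℙ.+_) (walkSign-horizontal (step v E) ds)
walkSign-horizontal v (W  ∷ ds) = cong (parityℤ (Vertex.m v) ⁻¹ ℙ.+_) (walkSign-horizontal (step v W) ds)
walkSign-horizontal v (NE ∷ ds) = walkSign-horizontal (step v NE) ds
walkSign-horizontal v (SW ∷ ds) = walkSign-horizontal (step v SW) ds
walkSign-horizontal v (NW ∷ ds) = walkSign-horizontal (step v NW) ds
walkSign-horizontal v (SE ∷ ds) = walkSign-horizontal (step v SE) ds

signℤ≡sign : ∀ k → scale (fromℤ (signℤ k)) I₂ ≡ sign (parity k) I₂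
signℤ≡sign zero          = refl
signℤ≡sign (suc zero)    = refl
signℤ≡sign (suc (suc k)) = trans (cong (λ z → scale (fromℤ z) I₂) (ℤP.neg-involutive (signℤ k))) (signℤ≡sign k)

mainTheorem4 : (ω : Zζ) → IsPrimitive8thRoot ω →
    (v : Vertex) (ds : List Dir) → SimpleClosedLoop v ds →
    (hs : List (ℤ × ℤ)) → Unique hs → (∀ x → (x ∈ hs) ⇔ Enclosed v ds x) →
    monodromy ω ds ≡ scale (fromℤ (signℤ (length hs))) I₂
mainTheorem4 ω ω-primitive v ds (valid , closed , _) hs unique enclosed = begin
  monodromy ω ds
    ≡⟨ closed-walk-monodromy ω G horizontalSign gauge-step-ω v ds (G-invertible v) valid closed ⟩
  sign (walkSign horizontalSign v ds) I₂
    ≡⟨ cong (λ p → sign p I₂) (walkSign-horizontal v ds) ⟩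
  sign (sumOver (horizEdges v ds) (λ e → parityℤ (proj₁ e) ⁻¹)) I₂
    ≡⟨ cong (λ p → sign p I₂) (enclosed-parity (horizEdges v ds) hs unique enclosed) ⟨
  sign (parity (length hs)) I₂
    ≡⟨ signℤ≡sign (length hs) ⟨
  scale (fromℤ (signℤ (length hs))) I₂ ∎
  where
  open ≡-Reasoning
  open QuaternionGauge (primitive⇒quaternion-relations ω ω-primitive)
  edge≡edgeMat : ∀ d → edge d ≡ edgeMat ω d
  edge≡edgeMat E  = refl
  edge≡edgeMat W  = refl
  edge≡edgeMat NE = refl
  edge≡edgeMat SW = refl
  edge≡edgeMat NW = refl
  edge≡edgeMat SE = refl
  gauge-step-ω : ∀ v d → T (allowed (Vertex.kind v) d) →
                 edgeMat ω d · G v ≡ sign (horizontalSign v d) (G (step v d))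
  gauge-step-ω v d allowed = subst (λ M → M · G v ≡ sign (horizontalSign v d) (G (step v d)))
                                   (edge≡edgeMat d) (gauge-step v d allowed)
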